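{- In the all-path convexity, every finite, simple, nonempty, connected graph $G$ satisfies $h(G)=i(G)$.
   Context: The all-path interval is $I(S)=S\cup\{v\in V\mid v$ lies on some path of $G$ whose two endpoints are distinct vertices of $S\}$; $S$ is convex if $I(S)=S$; $H(S)$ is the smallest convex set containing $S$. $i(G)$ is the minimum size of a set $S$ with $I(S)=V$, and the hull number $h(G)$ is the minimum size of a set $S$ with $H(S)=V$. -}

module Defs where

open import Data.Nat using (ℕ; suc; _≤_)
open import Data.Fin using (Fin)
open import Data.Fin.Subset using (Subset; _∈_; ∣_∣)
open import Data.List using (List; []; _∷_)
open import Data.List.Relation.Unary.Unique.Propositional using (Unique)
import Data.List.Membership.Propositional as LM
open import Data.Product using (Σ; _×_; ∃; ∃-syntax)
open import Data.Sum using (_⊎_)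
open import Relation.Nullary using (¬_; Dec)
open import Relation.Binary.PropositionalEquality using (_≡_)

record Graph (n : ℕ) : Set₁ where
  field
    Adj    : Fin n → Fin n → Set
    adj?   : ∀ u v → Dec (Adj u v)
    sym    : ∀ {u v} → Adj u v → Adj v u
    irrefl : ∀ {u} → ¬ Adj u u

module _ {n : ℕ} (G : Graph n) where
  open Graph G

  data Walk : Fin n → Fin n → List (Fin n) → Set where
    single : ∀ u → Walk u u (u ∷ [])
    step   : ∀ {u w v vs} → Adj u w → Walk w v vs → Walk u v (u ∷ vs)

  Path : Fin n → Fin n → List (Fin n) → Set
  Path u v vs = Walk u v vs × Unique vs

  Connected : Set
  Connected = ∀ u v → ∃[ vs ] Path u v vs

  InI : Subset n → Fin n → Set
  InI S x = x ∈ S ⊎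
            (∃[ u ] ∃[ v ] ∃[ vs ] (u ∈ S × v ∈ S × ¬ u ≡ v × Path u v vs × x LM.∈ vs))

  Convex : Subset n → Set
  Convex C = ∀ x → InI C x → x ∈ C

  IntervalSpanning : Subset n → Set
  IntervalSpanning S = ∀ x → InI S x

  HullSpanning : Subset n → Set
  HullSpanning S = ∀ C → (∀ x → x ∈ S → x ∈ C) → Convex C → ∀ x → x ∈ C

IsMinSize : {n : ℕ} → (Subset n → Set) → ℕ → Set
IsMinSize {n} P k = (∃[ S ] (P S × ∣ S ∣ ≡ k)) × (∀ S → P S → k ≤ ∣ S ∣)

IsIntervalNumber : {n : ℕ} → Graph n → ℕ → Set
IsIntervalNumber G = IsMinSize (IntervalSpanning G)

IsHullNumber : {n : ℕ} → Graph n → ℕ → Set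
IsHullNumber G = IsMinSize (HullSpanning G)

module Submission where

-- Trivially I(S) ⊆ H(S); the point is that I(S) is itself convex, so a set is interval-spanning
-- iff it is hull-spanning. Let x lie on a path from u to v, both in I(S), so that x sees u and v
-- along two rays sharing only x. Write u, v as vertices of S-paths Q₁, Q₂ (paths with both ends
-- in S, possibly trivial); if x is on neither, cut each ray at its first vertex c, d on Q₁ ∪ Q₂.
-- If c and d lie on a common S-path, say in that order, the part of it before c, the two rays and
-- the part after d form an S-path through x. Otherwise follow the S-path of d beyond d: either it
-- never meets the S-path of c again, and one concatenates as before, or it first does so at some
-- e, and the ray to d prolonged up to e reduces to the previous case.

open import Defs
open import Data.Bool using (true; T)
open import Data.Unit using (tt)
open import Data.Fin using (Fin; zero; suc; _≟_)
open import Data.Fin.Properties using (any?; injective⇒≤)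
open import Data.Fin.Subset using (Subset) renaming (_∈_ to _∈ₛ_)
open import Data.Fin.Subset.Properties using () renaming (_∈?_ to _∈ₛ?_)
open import Data.List using (List; []; _∷_; _++_; [_]; reverse; length; lookup; map; concatMap; allFin)
open import Data.List.Properties using (unfold-reverse; reverse-++)
open import Data.List.Membership.Propositional using (_∈_; _∉_; lose)
open import Data.List.Membership.Propositional.Properties
  using (∈-++⁺ˡ; ∈-++⁺ʳ; ∈-++⁻; ∈-∃++; ∈-lookup; ∈-map⁺; ∈-concatMap⁺; ∈-allFin)
import Data.List.Membership.DecPropositional as DecMembership
open import Data.List.Relation.Binary.Disjoint.Propositional using (Disjoint)
open import Data.List.Relation.Binary.Disjoint.Propositional.Properties
  using () renaming (sym to Disjoint-sym)
open import Data.List.Relation.Binary.Subset.Propositional using (_⊆_)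
open import Data.List.Relation.Binary.Subset.Propositional.Properties
  using (∷⁺ʳ) renaming (++⁺ʳ to ⊆-++⁺ʳ)
open import Data.List.Relation.Unary.All as All using (All; []; _∷_)
open import Data.List.Relation.Unary.All.Properties using (All¬⇒¬Any; ++⁻ˡ; ++⁻ʳ)
open import Data.List.Relation.Unary.AllPairs using ([]; _∷_)
open import Data.List.Relation.Unary.Any as Any using (Any; here; there)
open import Data.List.Relation.Unary.Any.Properties using (reverse⁺; reverse⁻)
import Data.List.Relation.Unary.First as First
open import Data.List.Relation.Unary.First.Properties using (¬All⇒First; toView)
open import Data.List.Relation.Unary.Unique.Propositional using (Unique)
open import Data.List.Relation.Unary.Unique.Propositional.Properties using (++⁺; Unique[x∷xs]⇒x∉xs)
import Data.List.Relation.Unary.Unique.DecPropositional as DecUnique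
open import Data.Nat using (ℕ; zero; suc; _≤_; s≤s)
open import Data.Nat.Properties using (≤-antisym)
open import Data.Product using (_×_; _,_; proj₁; proj₂; ∃; ∃-syntax; map₁)
open import Data.Sum using (_⊎_; inj₁; inj₂)
open import Data.Vec using (tabulate)
open import Data.Vec.Properties using (lookup∘tabulate; lookup⇒[]=; []=⇒lookup)
open import Function using (_∘_; id)
open import Function.Definitions using (Injective)
open import Relation.Nullary using (Dec; yes; no; does; contradiction)
open import Relation.Nullary.Decidable
  using (map′; _×-dec_; _⊎-dec_; ¬?; isYes; isYes≗does; dec-true; toWitness; decidable-stable)
open import Relation.Unary using (Pred; Decidable; ∁)
open import Relation.Binary.PropositionalEquality using (_≡_; _≢_; refl; sym; trans; cong; subst)

module _ {a} {A : Set a} where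

  private variable
    x y c : A
    xs ys zs ws K Q P : List A

  Disjoint-⊆ : xs ⊆ ys → zs ⊆ ws → Disjoint ys ws → Disjoint xs zs
  Disjoint-⊆ xs⊆ys zs⊆ws ys#ws (v∈xs , v∈zs) = ys#ws (xs⊆ys v∈xs , zs⊆ws v∈zs)

  Disjoint-++⁺ : Disjoint xs zs → Disjoint xs ws → Disjoint ys zs → Disjoint ys ws →
                 Disjoint (xs ++ ys) (zs ++ ws)
  Disjoint-++⁺ {xs = xs} {zs = zs} xs#zs xs#ws ys#zs ys#ws (v∈l , v∈r)
    with ∈-++⁻ xs v∈l | ∈-++⁻ zs v∈r
  ... | inj₁ v∈xs | inj₁ v∈zs = xs#zs (v∈xs , v∈zs)
  ... | inj₁ v∈xs | inj₂ v∈ws = xs#ws (v∈xs , v∈ws)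
  ... | inj₂ v∈ys | inj₁ v∈zs = ys#zs (v∈ys , v∈zs)
  ... | inj₂ v∈ys | inj₂ v∈ws = ys#ws (v∈ys , v∈ws)

  Unique-++⁻ : ∀ xs → Unique (xs ++ ys) → Unique xs × Unique ys × Disjoint xs ys
  Unique-++⁻ []       u          = [] , u , λ { (() , _) }
  Unique-++⁻ (x ∷ xs) (x∉ ∷ u) with Unique-++⁻ xs u
  ... | u-xs , u-ys , xs#ys = ++⁻ˡ xs x∉ ∷ u-xs , u-ys , λ where
    (here refl , v∈ys) → All.lookup (++⁻ʳ xs x∉) v∈ys refl
    (there v∈xs , v∈ys) → xs#ys (v∈xs , v∈ys)

  Unique-reverse⁺ : Unique xs → Unique (reverse xs)
  Unique-reverse⁺ {[]}     u          = u
  Unique-reverse⁺ {x ∷ xs} (x∉ ∷ u) rewrite unfold-reverse x xs =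
    ++⁺ (Unique-reverse⁺ u) ([] ∷ []) λ { (v∈ , here refl) → All.lookup x∉ (reverse⁻ v∈) refl }

  Unique-prefix : ∀ xs → Unique (xs ++ x ∷ ys) → Unique (xs ++ [ x ])
  Unique-prefix xs u with Unique-++⁻ xs u
  ... | u-xs , _ , xs#x∷ys = ++⁺ u-xs ([] ∷ []) λ { (v∈ , here refl) → xs#x∷ys (v∈ , here refl) }

  Unique-ordered⇒Disjoint : ∀ xs → Unique (xs ++ x ∷ ys ++ y ∷ zs) → Disjoint (x ∷ xs) (y ∷ zs)
  Unique-ordered⇒Disjoint {ys = ys} xs u with Unique-++⁻ xs u
  ... | _ , x∉ ∷ _ , xs# = λ where
    (here refl , v∈) → All.lookup x∉ (∈-++⁺ʳ ys v∈) refl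
    (there v∈xs , v∈) → xs# (v∈xs , there (∈-++⁺ʳ ys v∈))

  OccursBefore : A → A → List A → Set a
  OccursBefore x y Q = ∃[ xs ] ∃[ ys ] ∃[ zs ] Q ≡ xs ++ x ∷ ys ++ y ∷ zs

  occursBefore-total : ∀ Q → x ∈ Q → y ∈ Q → x ≢ y → OccursBefore x y Q ⊎ OccursBefore y x Q
  occursBefore-total (_ ∷ Q) (here refl) (here refl) x≢y = contradiction refl x≢y
  occursBefore-total (_ ∷ Q) (here refl) (there y∈) _ with ∈-∃++ y∈
  ... | ys , zs , refl = inj₁ ([] , ys , zs , refl)
  occursBefore-total (_ ∷ Q) (there x∈) (here refl) _ with ∈-∃++ x∈
  ... | ys , zs , refl = inj₂ ([] , ys , zs , refl)
  occursBefore-total (v ∷ Q) (there x∈) (there y∈) x≢y with occursBefore-total Q x∈ y∈ x≢y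
  ... | inj₁ (xs , ys , zs , refl) = inj₁ (v ∷ xs , ys , zs , refl)
  ... | inj₂ (xs , ys , zs , refl) = inj₂ (v ∷ xs , ys , zs , refl)

  split-at-first : ∀ {p} {R : Pred A p} → Decidable R → Any R xs →
                   ∃[ ys ] ∃[ y ] ∃[ zs ] xs ≡ ys ++ y ∷ zs × All (∁ R) ys × R y
  split-at-first R? r
    with toView (¬All⇒First (¬? ∘ R?) (λ {v} → decidable-stable (R? v)) (λ ¬r → All¬⇒¬Any ¬r r))
  ... | First._++_∷_ ¬rs ry _ = _ , _ , _ , refl , ¬rs , ry

  _meets_onlyAt_ : List A → List A → A → Set a
  K meets Q onlyAt c = ∀ {v} → v ∈ K → v ∈ Q → v ≡ c

  meetsOnlyAt-⊆ : P ⊆ Q → K meets Q onlyAt c → K meets P onlyAt c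
  meetsOnlyAt-⊆ P⊆Q K∩Q⊆c v∈K v∈P = K∩Q⊆c v∈K (P⊆Q v∈P)

  meetsOnlyAt⇒Disjoint : K meets Q onlyAt c → c ∉ P → P ⊆ Q → Disjoint K P
  meetsOnlyAt⇒Disjoint K∩Q⊆c c∉P P⊆Q (v∈K , v∈P) = c∉P (subst (_∈ _) (K∩Q⊆c v∈K (P⊆Q v∈P)) v∈P)

  Unique⇒lookup-injective : Unique xs → Injective _≡_ _≡_ (lookup xs)
  Unique⇒lookup-injective {_ ∷ _} _        {zero}  {zero}  _  = refl
  Unique⇒lookup-injective {_ ∷ _} (x∉ ∷ _) {zero}  {suc j} eq =
    contradiction eq (All.lookup x∉ (∈-lookup j))
  Unique⇒lookup-injective {_ ∷ _} (x∉ ∷ _) {suc i} {zero}  eq =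
    contradiction (sym eq) (All.lookup x∉ (∈-lookup i))
  Unique⇒lookup-injective {_ ∷ _} (_ ∷ u)  {suc i} {suc j} eq = cong suc (Unique⇒lookup-injective u eq)

module _ {m : ℕ} where

  Unique⇒length≤ : {vs : List (Fin m)} → Unique vs → length vs ≤ m
  Unique⇒length≤ u = injective⇒≤ (Unique⇒lookup-injective u)

  lists≤ : ℕ → List (List (Fin m))
  lists≤ zero    = [ [] ]
  lists≤ (suc k) = [] ∷ concatMap (λ y → map (y ∷_) (lists≤ k)) (allFin m)

  ∈-lists≤ : ∀ k {vs} → length vs ≤ k → vs ∈ lists≤ k
  ∈-lists≤ zero    {[]}     _         = here refl
  ∈-lists≤ (suc k) {[]}     _         = here refl
  ∈-lists≤ (suc k) {y ∷ vs} (s≤s |vs|≤k) =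
    there (∈-concatMap⁺ _ (lose (∈-allFin y) (∈-map⁺ (y ∷_) (∈-lists≤ k |vs|≤k))))

  ∃-unique? : ∀ {ℓ} {P : Pred (List (Fin m)) ℓ} → Decidable P → (∀ {vs} → P vs → Unique vs) → Dec (∃ P)
  ∃-unique? P? P⇒Unique = map′ Any.satisfied
    (λ (vs , pvs) → lose (∈-lists≤ m (Unique⇒length≤ (P⇒Unique pvs))) pvs)
    (Any.any? P? (lists≤ m))

  subset : ∀ {ℓ} {P : Pred (Fin m) ℓ} → Decidable P → Subset m
  subset P? = tabulate (does ∘ P?)

  module _ {ℓ} {P : Pred (Fin m) ℓ} (P? : Decidable P) {x : Fin m} where

    ∈-subset⁺ : P x → x ∈ₛ subset P?
    ∈-subset⁺ px = lookup⇒[]= x _ (trans (lookup∘tabulate _ x) (dec-true (P? x) px))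

    ∈-subset⁻ : x ∈ₛ subset P? → P x
    ∈-subset⁻ x∈ = toWitness {a? = P? x} (subst T (sym yes≡true) tt)
      where
      yes≡true : isYes (P? x) ≡ true
      yes≡true = trans (isYes≗does (P? x)) (trans (sym (lookup∘tabulate _ x)) ([]=⇒lookup x∈))

module _ {n : ℕ} (G : Graph n) where

  open Graph G renaming (sym to Adj-sym)
  open DecMembership (_≟_ {n}) using (_∈?_)
  open DecUnique (_≟_ {n}) using (unique?)

  private variable
    u v w x y c d : Fin n
    vs xs ys A B K L Q Q′ U R R′ post : List (Fin n)

  Walk-head : Walk G u v (w ∷ vs) → u ≡ w
  Walk-head (single _) = refl
  Walk-head (step _ _) = refl

  Walk-last : Walk G u v vs → v ∈ vs
  Walk-last (single _) = here refl
  Walk-last (step _ p) = there (Walk-last p)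

  Walk-last-tail : Walk G x u (x ∷ A) → x ≢ u → u ∈ A
  Walk-last-tail p x≢u with Walk-last p
  ... | here u≡x  = contradiction (sym u≡x) x≢u
  ... | there u∈A = u∈A

  Walk-++ : Walk G u y xs → Walk G y v (y ∷ ys) → Walk G u v (xs ++ ys)
  Walk-++ (single _) q = q
  Walk-++ (step a p) q = step a (Walk-++ p q)

  Walk-reverse : Walk G u v vs → Walk G v u (reverse vs)
  Walk-reverse (single u) = single u
  Walk-reverse {u = u} (step {vs = vs} a p) rewrite unfold-reverse u vs =
    Walk-++ (Walk-reverse p) (step (Adj-sym a) (single u))

  Walk-split : ∀ pre → Walk G u v (pre ++ x ∷ post) → Walk G u x (pre ++ [ x ]) × Walk G x v (x ∷ post)
  Walk-split []          (single _) = single _ , single _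
  Walk-split []          (step a p) = single _ , step a p
  Walk-split (_ ∷ [])    (step a p) = map₁ (step a) (Walk-split [] p)
  Walk-split (_ ∷ _ ∷ _) (step a p) = map₁ (step a) (Walk-split (_ ∷ _) p)

  Path-++ : Path G u y xs → Path G y v (y ∷ ys) → Disjoint xs ys → Path G u v (xs ++ ys)
  Path-++ (p , u-xs) (q , _ ∷ u-ys) xs#ys = Walk-++ p q , ++⁺ u-xs u-ys xs#ys

  Path-reverse : Path G u v vs → Path G v u (reverse vs)
  Path-reverse (p , u-vs) = Walk-reverse p , Unique-reverse⁺ u-vs

  Path-split : ∀ pre → Path G u v (pre ++ x ∷ post) → Path G u x (pre ++ [ x ]) × Path G x v (x ∷ post)
  Path-split pre (p , u-vs) with Walk-split pre p | Unique-++⁻ pre u-vs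
  ... | p₁ , p₂ | _ , u-post , _ = (p₁ , Unique-prefix pre u-vs) , (p₂ , u-post)

  Path-rays : ∀ pre → Path G u v (pre ++ x ∷ post) →
              Path G x u (x ∷ reverse pre) × Path G x v (x ∷ post) × Disjoint (reverse pre) post
  Path-rays {x = x} pre p@(_ , u-vs) with Path-split pre p | Unique-++⁻ pre u-vs
  ... | p₁ , p₂ | _ , _ , pre#x∷post rewrite sym (reverse-++ pre [ x ]) =
    Path-reverse p₁ , p₂ , Disjoint-⊆ reverse⁻ there pre#x∷post

  Path-loop : Path G u u vs → x ∈ vs → x ≡ u
  Path-loop (single _ , _)   (here refl) = refl
  Path-loop (step _ p , u-vs) _          = contradiction (Walk-last p) (Unique[x∷xs]⇒x∉xs u-vs)

  step⁻ : Walk G u v (w ∷ y ∷ vs) → Adj u y × Walk G y v (y ∷ vs)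
  step⁻ (step a (single _)) = a , single _
  step⁻ (step a (step b p)) = a , step b p

  Walk? : ∀ u v vs → Dec (Walk G u v vs)
  Walk? u v []           = no λ ()
  Walk? u v (w ∷ [])     = map′ (λ { (refl , refl) → single u }) (λ { (single _) → refl , refl })
                                (u ≟ w ×-dec v ≟ w)
  Walk? u v (w ∷ y ∷ vs) = map′ (λ { (refl , a , p) → step a p }) (λ p → Walk-head p , step⁻ p)
                                (u ≟ w ×-dec adj? u y ×-dec Walk? y v (y ∷ vs))

  Path? : ∀ u v vs → Dec (Path G u v vs)
  Path? u v vs = Walk? u v vs ×-dec unique? vs

  FirstEntry : List (Fin n) → Fin n → List (Fin n) → Set
  FirstEntry U x A =
    ∃[ c ] ∃[ K ] c ∈ U × c ∈ A × K ⊆ A × Path G x c (x ∷ K) × (x ∷ K) meets U onlyAt c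

  firstEntry : x ∉ U → u ∈ U → Path G x u (x ∷ A) → FirstEntry U x A
  firstEntry {x = x} {U = U} x∉U u∈U p
    with split-at-first (_∈? U) (lose (Walk-last-tail (proj₁ p) λ { refl → x∉U u∈U }) u∈U)
  ... | K , c , _ , refl , K∌ , c∈U =
    c , K ++ [ c ] , c∈U , ∈-++⁺ʳ K (here refl) , ⊆-++⁺ʳ K (∷⁺ʳ c λ ()) ,
    proj₁ (Path-split (x ∷ K) p) , entry
    where
    entry : (x ∷ K ++ [ c ]) meets U onlyAt c
    entry (here refl) v∈U = contradiction v∈U x∉U
    entry (there v∈) v∈U with ∈-++⁻ K v∈
    ... | inj₁ v∈K        = contradiction v∈U (All.lookup K∌ v∈K)
    ... | inj₂ (here refl) = refl

  module _ (S : Subset n) where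

    -- Unlike in I(S), the two ends may coincide; S-paths through x thus cover the case x ∈ S.
    SPath : List (Fin n) → Set
    SPath Q = ∃[ s ] ∃[ t ] s ∈ₛ S × t ∈ₛ S × Path G s t Q

    OnSPath : Fin n → Set
    OnSPath x = ∃[ Q ] SPath Q × x ∈ Q

    PathToS : Fin n → List (Fin n) → Set
    PathToS x R = ∃[ t ] t ∈ₛ S × Path G x t (x ∷ R)

    InI⇒OnSPath : InI G S x → OnSPath x
    InI⇒OnSPath {x = x} (inj₁ x∈S) = [ x ] , (x , x , x∈S , x∈S , single x , [] ∷ []) , here refl
    InI⇒OnSPath (inj₂ (s , t , Q , s∈S , t∈S , _ , p , x∈Q)) = Q , (s , t , s∈S , t∈S , p) , x∈Q

    OnSPath⇒InI : OnSPath x → InI G S x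
    OnSPath⇒InI (Q , (s , t , s∈S , t∈S , p) , x∈Q) with s ≟ t
    ... | yes refl = inj₁ (subst (_∈ₛ S) (sym (Path-loop p x∈Q)) s∈S)
    ... | no s≢t   = inj₂ (s , t , Q , s∈S , t∈S , s≢t , p , x∈Q)

    PathToS-start∉ : PathToS x R → x ∉ R
    PathToS-start∉ (_ , _ , _ , u) = Unique[x∷xs]⇒x∉xs u

    PathToS-extend : Path G x c (x ∷ K) → PathToS c R → Disjoint (x ∷ K) R → PathToS x (K ++ R)
    PathToS-extend p (t , t∈S , q) x∷K#R = t , t∈S , Path-++ p q x∷K#R

    PathToS-suffix : ∀ R → PathToS c (R ++ d ∷ R′) → PathToS d R′
    PathToS-suffix {c = c} R (t , t∈S , p) = t , t∈S , proj₂ (Path-split (c ∷ R) p)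

    SPath-split : ∀ pre → SPath (pre ++ c ∷ post) → PathToS c (reverse pre) × PathToS c post
    SPath-split {c = c} pre (s , t , s∈S , t∈S , p) with Path-split pre p
    ... | p₁ , p₂ rewrite sym (reverse-++ pre [ c ]) = (s , s∈S , Path-reverse p₁) , (t , t∈S , p₂)

    PathsToS⇒OnSPath : PathToS x R → PathToS x R′ → Disjoint R R′ → OnSPath x
    PathsToS⇒OnSPath {x = x} {R = R} {R′ = R′} (s , s∈S , p) (t , t∈S , q@(_ , u)) R#R′ =
      reverse (x ∷ R) ++ R′ , (s , t , s∈S , t∈S , Path-++ (Path-reverse p) q x∷R#R′) ,
      ∈-++⁺ˡ (reverse⁺ {xs = x ∷ R} (here refl))
      where
      x∷R#R′ : Disjoint (reverse (x ∷ R)) R′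
      x∷R#R′ (v∈ , v∈R′) with reverse⁻ {xs = x ∷ R} v∈
      ... | here refl = Unique[x∷xs]⇒x∉xs u v∈R′
      ... | there v∈R = R#R′ (v∈R , v∈R′)

    joinRays⇒OnSPath : Path G x c (x ∷ K) → Path G x d (x ∷ L) → PathToS c R → PathToS d R′ →
      Disjoint (x ∷ K) R → Disjoint (x ∷ K) R′ → Disjoint (x ∷ L) R → Disjoint (x ∷ L) R′ →
      Disjoint K L → Disjoint R R′ → OnSPath x
    joinRays⇒OnSPath p q c→S d→S xK#R xK#R′ xL#R xL#R′ K#L R#R′ =
      PathsToS⇒OnSPath (PathToS-extend p c→S xK#R) (PathToS-extend q d→S xL#R′)
        (Disjoint-++⁺ K#L (Disjoint-⊆ there id xK#R′) (Disjoint-sym (Disjoint-⊆ there id xL#R)) R#R′)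

    fan-ordered : ∀ pre mid post → SPath (pre ++ c ∷ mid ++ d ∷ post) →
      Path G x c (x ∷ K) → Path G x d (x ∷ L) →
      (x ∷ K) meets (pre ++ c ∷ mid ++ d ∷ post) onlyAt c →
      (x ∷ L) meets (pre ++ c ∷ mid ++ d ∷ post) onlyAt d →
      Disjoint K L → OnSPath x
    fan-ordered {c = c} {d = d} pre mid post sp@(_ , _ , _ , _ , _ , u) p q K∩Q L∩Q K#L =
      joinRays⇒OnSPath p q c→S d→S
        (meetsOnlyAt⇒Disjoint K∩Q (PathToS-start∉ c→S) pre′⊆Q)
        (meetsOnlyAt⇒Disjoint K∩Q (λ c∈post → c∷pre#d∷post (here refl , there c∈post)) post⊆Q)
        (meetsOnlyAt⇒Disjoint L∩Q (λ d∈pre′ → c∷pre#d∷post (there (reverse⁻ {xs = pre} d∈pre′) , here refl))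
          pre′⊆Q)
        (meetsOnlyAt⇒Disjoint L∩Q (PathToS-start∉ d→S) post⊆Q)
        K#L
        (Disjoint-⊆ (there ∘ reverse⁻ {xs = pre}) there c∷pre#d∷post)
      where
      c∷pre#d∷post : Disjoint (c ∷ pre) (d ∷ post)
      c∷pre#d∷post = Unique-ordered⇒Disjoint pre u
      c→S : PathToS c (reverse pre)
      c→S = proj₁ (SPath-split pre sp)
      d→S : PathToS d post
      d→S = PathToS-suffix mid (proj₂ (SPath-split pre sp))
      pre′⊆Q : reverse pre ⊆ pre ++ c ∷ mid ++ d ∷ post
      pre′⊆Q = ∈-++⁺ˡ ∘ reverse⁻ {xs = pre}
      post⊆Q : post ⊆ pre ++ c ∷ mid ++ d ∷ post
      post⊆Q = ∈-++⁺ʳ pre ∘ there ∘ ∈-++⁺ʳ mid ∘ there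

    fan-one : SPath Q → c ∈ Q → d ∈ Q → c ≢ d → Path G x c (x ∷ K) → Path G x d (x ∷ L) →
          (x ∷ K) meets Q onlyAt c → (x ∷ L) meets Q onlyAt d → Disjoint K L → OnSPath x
    fan-one {Q = Q} sp c∈Q d∈Q c≢d p q K∩Q L∩Q K#L with occursBefore-total Q c∈Q d∈Q c≢d
    ... | inj₁ (pre , mid , post , refl) = fan-ordered pre mid post sp p q K∩Q L∩Q K#L
    ... | inj₂ (pre , mid , post , refl) = fan-ordered pre mid post sp q p L∩Q K∩Q (Disjoint-sym K#L)

    fan-across : SPath Q → SPath Q′ → c ∈ Q → d ∈ Q′ → Path G x c (x ∷ K) → Path G x d (x ∷ L) →
      (x ∷ K) meets Q onlyAt c → (x ∷ L) meets Q′ onlyAt d → Disjoint (x ∷ K) Q′ → Disjoint (x ∷ L) Q →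
      Disjoint K L → OnSPath x
    fan-across {Q = Q} {Q′ = Q′} {c = c} {d = d} {x = x} {K = K} {L = L}
               sp sp′ c∈Q d∈Q′ p q K∩Q L∩Q′ xK#Q′ xL#Q K#L with ∈-∃++ c∈Q | ∈-∃++ d∈Q′
    ... | pre , _ , refl | pre′ , post′ , refl with Any.any? (_∈? Q) post′
    ... | no post′∌ =
      joinRays⇒OnSPath p q c→S d→S
        (meetsOnlyAt⇒Disjoint K∩Q (PathToS-start∉ c→S) pre⊆Q)
        (Disjoint-⊆ id post′⊆Q′ xK#Q′)
        (Disjoint-⊆ id pre⊆Q xL#Q)
        (meetsOnlyAt⇒Disjoint L∩Q′ (PathToS-start∉ d→S) post′⊆Q′)
        K#L
        (λ (v∈pre , v∈post′) → post′∌ (lose v∈post′ (pre⊆Q v∈pre)))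
      where
      c→S : PathToS c (reverse pre)
      c→S = proj₁ (SPath-split pre sp)
      d→S : PathToS d post′
      d→S = proj₂ (SPath-split pre′ sp′)
      pre⊆Q : reverse pre ⊆ Q
      pre⊆Q = ∈-++⁺ˡ ∘ reverse⁻ {xs = pre}
      post′⊆Q′ : post′ ⊆ Q′
      post′⊆Q′ = ∈-++⁺ʳ pre′ ∘ there
    ... | yes post′∩Q with split-at-first (_∈? Q) post′∩Q
    ... | r , e , r′ , refl , r∌ , e∈Q = fan-one sp c∈Q e∈Q c≢e p x→e K∩Q L′∩Q K#L′
      where
      d→S : PathToS d (r ++ e ∷ r′)
      d→S = proj₂ (SPath-split pre′ sp′)
      r∷ʳe⊆ : r ++ [ e ] ⊆ r ++ e ∷ r′
      r∷ʳe⊆ = ⊆-++⁺ʳ r (∷⁺ʳ e λ ())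
      xL#r∷ʳe : Disjoint (x ∷ L) (r ++ [ e ])
      xL#r∷ʳe = meetsOnlyAt⇒Disjoint L∩Q′ (PathToS-start∉ d→S ∘ r∷ʳe⊆) (∈-++⁺ʳ pre′ ∘ there ∘ r∷ʳe⊆)
      x→e : Path G x e (x ∷ L ++ r ++ [ e ])
      x→e = Path-++ q (proj₁ (Path-split (d ∷ r) (proj₂ (proj₂ d→S)))) xL#r∷ʳe
      L′∩Q : (x ∷ L ++ r ++ [ e ]) meets Q onlyAt e
      L′∩Q v∈ v∈Q with ∈-++⁻ (x ∷ L) v∈
      ... | inj₁ v∈xL = contradiction (v∈xL , v∈Q) xL#Q
      ... | inj₂ v∈re with ∈-++⁻ r v∈re
      ...   | inj₁ v∈r        = contradiction v∈Q (All.lookup r∌ v∈r)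
      ...   | inj₂ (here refl) = refl
      K#L′ : Disjoint K (L ++ r ++ [ e ])
      K#L′ (v∈K , v∈) with ∈-++⁻ L v∈
      ... | inj₁ v∈L  = K#L (v∈K , v∈L)
      ... | inj₂ v∈re = xK#Q′ (there v∈K , ∈-++⁺ʳ pre′ (there (r∷ʳe⊆ v∈re)))
      c≢e : c ≢ e
      c≢e refl = xK#Q′ (Walk-last (proj₁ p) , ∈-++⁺ʳ pre′ (there (∈-++⁺ʳ r (here refl))))

    fan : SPath Q → SPath Q′ → Q ⊆ U → Q′ ⊆ U → c ∈ Q → d ∈ Q′ → c ≢ d →
      Path G x c (x ∷ K) → Path G x d (x ∷ L) →
      (x ∷ K) meets U onlyAt c → (x ∷ L) meets U onlyAt d → Disjoint K L → OnSPath x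
    fan {Q = Q} {Q′ = Q′} {c = c} {d = d} sp sp′ Q⊆U Q′⊆U c∈Q d∈Q′ c≢d p q K∩U L∩U K#L
      with d ∈? Q | c ∈? Q′
    ... | yes d∈Q | _ =
      fan-one sp c∈Q d∈Q c≢d p q (meetsOnlyAt-⊆ Q⊆U K∩U) (meetsOnlyAt-⊆ Q⊆U L∩U) K#L
    ... | no _ | yes c∈Q′ =
      fan-one sp′ c∈Q′ d∈Q′ c≢d p q (meetsOnlyAt-⊆ Q′⊆U K∩U) (meetsOnlyAt-⊆ Q′⊆U L∩U) K#L
    ... | no d∉Q | no c∉Q′ =
      fan-across sp sp′ c∈Q d∈Q′ p q (meetsOnlyAt-⊆ Q⊆U K∩U) (meetsOnlyAt-⊆ Q′⊆U L∩U)
        (meetsOnlyAt⇒Disjoint K∩U c∉Q′ Q′⊆U) (meetsOnlyAt⇒Disjoint L∩U d∉Q Q⊆U) K#L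

    SPath-containing : SPath Q → SPath Q′ → c ∈ Q ++ Q′ → ∃[ Q″ ] SPath Q″ × Q″ ⊆ Q ++ Q′ × c ∈ Q″
    SPath-containing {Q = Q} sp sp′ c∈ with ∈-++⁻ Q c∈
    ... | inj₁ c∈Q  = _ , sp , ∈-++⁺ˡ , c∈Q
    ... | inj₂ c∈Q′ = _ , sp′ , ∈-++⁺ʳ Q , c∈Q′

    rays⇒OnSPath : OnSPath u → OnSPath v → Path G x u (x ∷ A) → Path G x v (x ∷ B) → Disjoint A B →
                   OnSPath x
    rays⇒OnSPath {x = x} (Q , sp , u∈Q) (Q′ , sp′ , v∈Q′) p q A#B with x ∈? Q ++ Q′
    ... | yes x∈U = let Q″ , sp″ , _ , x∈Q″ = SPath-containing sp sp′ x∈U in Q″ , sp″ , x∈Q″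
    ... | no x∉U with firstEntry x∉U (∈-++⁺ˡ u∈Q) p | firstEntry x∉U (∈-++⁺ʳ Q v∈Q′) q
    ... | c , K , c∈U , c∈A , K⊆A , p′ , K∩U | d , L , d∈U , d∈B , L⊆B , q′ , L∩U
      with SPath-containing sp sp′ c∈U | SPath-containing sp sp′ d∈U
    ... | _ , spc , Qc⊆U , c∈Qc | _ , spd , Qd⊆U , d∈Qd =
      fan spc spd Qc⊆U Qd⊆U c∈Qc d∈Qd (λ { refl → A#B (c∈A , d∈B) }) p′ q′ K∩U L∩U
        (Disjoint-⊆ K⊆A L⊆B A#B)

    InI-convex : InI G S u → InI G S v → Path G u v vs → x ∈ vs → InI G S x
    InI-convex u∈I v∈I p x∈vs with ∈-∃++ x∈vs
    ... | pre , _ , refl with Path-rays pre p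
    ... | x→u , x→v , pre′#post =
      OnSPath⇒InI (rays⇒OnSPath (InI⇒OnSPath u∈I) (InI⇒OnSPath v∈I) x→u x→v pre′#post)

    InI-mono : ∀ {T} → (∀ y → y ∈ₛ S → y ∈ₛ T) → InI G S x → InI G T x
    InI-mono S⊆T (inj₁ x∈S) = inj₁ (S⊆T _ x∈S)
    InI-mono S⊆T (inj₂ (s , t , vs , s∈S , t∈S , rest)) =
      inj₂ (s , t , vs , S⊆T s s∈S , S⊆T t t∈S , rest)

    IntervalSpanning⇒HullSpanning : IntervalSpanning G S → HullSpanning G S
    IntervalSpanning⇒HullSpanning I-spans C S⊆C C-convex x = C-convex x (InI-mono S⊆C (I-spans x))

    InI? : Decidable (InI G S)
    InI? x = x ∈ₛ? S ⊎-dec any? λ s → any? λ t →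
      ∃-unique? (through? s t) (λ (_ , _ , _ , (_ , u) , _) → u)
      where
      through? : ∀ s t vs → Dec (s ∈ₛ S × t ∈ₛ S × s ≢ t × Path G s t vs × x ∈ vs)
      through? s t vs = s ∈ₛ? S ×-dec t ∈ₛ? S ×-dec ¬? (s ≟ t) ×-dec Path? s t vs ×-dec x ∈? vs

    interval-convex : Convex G (subset InI?)
    interval-convex x (inj₁ x∈I) = x∈I
    interval-convex x (inj₂ (s , t , _ , s∈I , t∈I , _ , p , x∈vs)) =
      ∈-subset⁺ InI? (InI-convex (∈-subset⁻ InI? s∈I) (∈-subset⁻ InI? t∈I) p x∈vs)

    HullSpanning⇒IntervalSpanning : HullSpanning G S → IntervalSpanning G S
    HullSpanning⇒IntervalSpanning H-spans x =
      ∈-subset⁻ InI? (H-spans (subset InI?) (λ y y∈S → ∈-subset⁺ InI? (inj₁ y∈S)) interval-convex x)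

corollary7 : (n : ℕ) (G : Graph (suc n)) → Connected G →
    (h i : ℕ) → IsHullNumber G h → IsIntervalNumber G i → h ≡ i
corollary7 n G _ h i ((S₁ , H-spans , |S₁|≡h) , h-min) ((S₀ , I-spans , |S₀|≡i) , i-min) = ≤-antisym
  (subst (h ≤_) |S₀|≡i (h-min S₀ (IntervalSpanning⇒HullSpanning G S₀ I-spans)))
  (subst (i ≤_) |S₁|≡h (i-min S₁ (HullSpanning⇒IntervalSpanning G S₁ H-spans)))
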